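{- Let $m$ and $n$ be odd integers with $m\geq 9$ and $n\geq 3$. Then $\chi_{lid}(C_m\times C_n)=4$.
   Context: $C_n$ denotes the cycle on $n$ vertices. A proper $k$-coloring of a graph $G$ is a map $f:V(G)\to\{1,\dots,k\}$ with $f(u)\neq f(v)$ for every edge $uv$. For a vertex $v$, $N[v]$ denotes its closed neighborhood, and $f(S)=\{f(x):x\in S\}$. A lid-coloring of $G$ is a proper coloring $f$ such that for every edge $uv$ with $N[u]\neq N[v]$ we have $f(N[u])\neq f(N[v])$; $\chi_{lid}(G)$ is the smallest number of colors in a lid-coloring of $G$. The tensor product $G\times H$ has vertex set $V(G)\times V(H)$, where $(u_1,v_1)$ and $(u_2,v_2)$ are adjacent iff $u_1u_2\in E(G)$ and $v_1v_2\in E(H)$. -}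

module Defs where

open import Level using (0ℓ)
open import Data.Nat using (ℕ; suc; _<_; _+_; _*_)
open import Data.Fin using (Fin; toℕ)
open import Data.Product using (Σ; _×_; _,_; ∃)
open import Data.Sum using (_⊎_)
open import Relation.Nullary using (¬_)
open import Relation.Binary.PropositionalEquality using (_≡_)
open import Function.Bundles using (_⇔_)

record Graph : Set₁ where
  field
    V   : Set
    _~_ : V → V → Set
open Graph public

CycSucc : (n : ℕ) → Fin n → Fin n → Set
CycSucc n i j = (toℕ j ≡ suc (toℕ i)) ⊎ ((suc (toℕ i) ≡ n) × (toℕ j ≡ 0))

-- Cycle C_n on vertex set Fin n: i ~ j iff j ≡ i+1 (mod n) or i ≡ j+1 (mod n).
-- (Only used with n ≥ 3, where this is the usual simple cycle.)
Cycle : ℕ → Graph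
Cycle n = record
  { V = Fin n
  ; _~_ = λ i j → CycSucc n i j ⊎ CycSucc n j i
  }

-- Tensor (direct / categorical) product G × H.
_⊗_ : Graph → Graph → Graph
G ⊗ H = record
  { V = V G × V H
  ; _~_ = λ p q → (_~_ G (Data.Product.proj₁ p) (Data.Product.proj₁ q))
                × (_~_ H (Data.Product.proj₂ p) (Data.Product.proj₂ q))
  }

module _ (G : Graph) where
  N[_] : V G → V G → Set
  N[ v ] x = (x ≡ v) ⊎ (_~_ G v x)

  image : {k : ℕ} → (V G → Fin k) → (V G → Set) → Fin k → Set
  image f S c = Σ (V G) λ x → S x × (f x ≡ c)

  SameSet : {A : Set} → (A → Set) → (A → Set) → Set
  SameSet S T = ∀ a → S a ⇔ T a

  IsProperColoring : {k : ℕ} → (V G → Fin k) → Set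
  IsProperColoring f = ∀ u v → _~_ G u v → ¬ (f u ≡ f v)

  IsLidColoring : {k : ℕ} → (V G → Fin k) → Set
  IsLidColoring f = IsProperColoring f
    × (∀ u v → _~_ G u v → ¬ SameSet N[ u ] N[ v ]
         → ¬ SameSet (image f N[ u ]) (image f N[ v ]))

  LidColorable : ℕ → Set
  LidColorable k = Σ (V G → Fin k) IsLidColoring

  χlid≡ : ℕ → Set
  χlid≡ k = LidColorable k × (∀ j → j < k → ¬ LidColorable j)

Odd : ℕ → Set
Odd m = Σ ℕ λ k → m ≡ suc (2 * k)

-- Lower bound: with three colours, an edge uv with N[u] ≠ N[v] has exactly one endpoint whose
-- closed neighbourhood sees all three colours (if both or neither did, f(N[u]) = f(N[v])).
-- So this alternates along a walk through such edges, which is impossible on a closed walk of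
-- odd length; the diagonal walk t ↦ (t mod m, t mod n) of C_m × C_n is one, of length mn.
-- Upper bound: colour (x, y) by g(x) for a colouring g of C_m. The colours seen by N[(x, y)]
-- are g(x-1), g(x), g(x+1), so g∘proj₁ is a lid-colouring as soon as any four consecutive
-- colours a b c d of g satisfy a ≠ b ≠ c ≠ d and {a, b, c} ≠ {b, c, d}. For odd m ≥ 9 the
-- cyclic words (0102)^i 01323 and (0102)^i 0131203 (i ≥ 1) do this.
module Submission where

open import Defs
open import Data.Nat using (ℕ; zero; suc; _+_; _*_; _<_; _≤_; _≥_; _%_; _/_; s≤s; z≤n)
open import Data.Nat.Properties
  using (+-comm; +-assoc; +-suc; +-identityʳ; +-cancelˡ-≡; +-monoʳ-<; *-suc; *-assoc; *-distribˡ-+;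
         *-cancelˡ-≤; ≤-pred; ≤-trans; <-trans; <-irrefl; <⇒≱; n<1+n; m≤n⇒m<n∨m≡n; m≤n⇒∃[o]m+o≡n)
open import Data.Nat.DivMod
  using (_mod_; %-distribˡ-+; m%n%n≡m%n; [m+kn]%n≡m%n; m≡m%n+[m/n]*n; m<n⇒m%n≡m; n%n≡0)
open import Data.Nat.Divisibility using (_∣_; divides; ∣⇒≤; ∣-refl; ∣-reflexive; m∣m*n; n∣m*n)
open import Data.Fin using (Fin; zero; suc; toℕ; inject≤; #_; _≟_)
open import Data.Fin.Properties
  using (toℕ-injective; toℕ<n; toℕ-fromℕ<; inject≤-injective; punchOut-injective)
open import Data.List using (List; []; _∷_; _++_; length)
open import Data.List.Properties using (length-++)
open import Data.Product using (∃; _×_; _,_; proj₁; proj₂)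
import Data.Product as Product
open import Data.Sum using (_⊎_; inj₁; inj₂)
import Data.Sum as Sum
open import Data.Unit using (⊤; tt)
open import Data.Bool using (T)
open import Data.Empty using (⊥-elim)
open import Function using (_∘_)
open import Function.Bundles using (mk⇔; Equivalence)
open import Function.Construct.Symmetry using (⇔-sym)
open import Function.Construct.Composition using (_⇔-∘_)
open import Relation.Binary.Definitions using (Symmetric)
open import Relation.Binary.PropositionalEquality
  using (_≡_; _≢_; refl; sym; trans; cong; cong₂; subst; module ≡-Reasoning)
open import Relation.Nullary using (¬_; Dec; does; yes; no)
open import Relation.Nullary.Decidable using (toWitness; isYes≗does; _×-dec_; ¬?)

open ≡-Reasoning

SameSet-sym : ∀ G {A : Set} {S T : A → Set} → SameSet G S T → SameSet G T S
SameSet-sym G same = ⇔-sym ∘ same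

LidColorable-mono : ∀ G {j k} → j ≤ k → LidColorable G j → LidColorable G k
LidColorable-mono G {j} {k} j≤k (f , proper , lid) = inject ∘ f , proper′ , lid′
  where
  inject : Fin j → Fin k
  inject c = inject≤ c j≤k

  inject-injective : ∀ {c d} → inject c ≡ inject d → c ≡ d
  inject-injective = inject≤-injective j≤k j≤k _ _

  proper′ : IsProperColoring G (inject ∘ f)
  proper′ u v u~v = proper u v u~v ∘ inject-injective

  push : ∀ {S c} → image G f S c → image G (inject ∘ f) S (inject c)
  push (x , x∈S , refl) = x , x∈S , refl

  pull : ∀ {S c} → image G (inject ∘ f) S (inject c) → image G f S c
  pull (x , x∈S , e) = x , x∈S , inject-injective e

  lid′ : ∀ u v → _~_ G u v → ¬ SameSet G (N[_] G u) (N[_] G v) →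
         ¬ SameSet G (image G (inject ∘ f) (N[_] G u)) (image G (inject ∘ f) (N[_] G v))
  lid′ u v u~v N≢ same = lid u v u~v N≢ λ c →
    mk⇔ (pull ∘ Equivalence.to (same (inject c)) ∘ push)
        (pull ∘ Equivalence.from (same (inject c)) ∘ push)

Fin2-≢-unique : {p q r : Fin 2} → p ≢ r → q ≢ r → p ≡ q
Fin2-≢-unique {zero}     {zero}                 _   _   = refl
Fin2-≢-unique {suc zero} {suc zero}             _   _   = refl
Fin2-≢-unique {zero}     {suc zero} {zero}      p≢r _   = ⊥-elim (p≢r refl)
Fin2-≢-unique {zero}     {suc zero} {suc zero}  _   q≢r = ⊥-elim (q≢r refl)
Fin2-≢-unique {suc zero} {zero}     {zero}      _   q≢r = ⊥-elim (q≢r refl)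
Fin2-≢-unique {suc zero} {zero}     {suc zero}  p≢r _   = ⊥-elim (p≢r refl)

-- Punching a out of Fin 3 leaves Fin 2, where b takes one value and x, y the other.
Fin3-≢-unique : {a b x y : Fin 3} → a ≢ b → x ≢ a → x ≢ b → y ≢ a → y ≢ b → x ≡ y
Fin3-≢-unique a≢b x≢a x≢b y≢a y≢b =
  punchOut-injective a≢x a≢y
    (Fin2-≢-unique (x≢b ∘ punchOut-injective a≢x a≢b) (y≢b ∘ punchOut-injective a≢y a≢b))
  where
  a≢x = x≢a ∘ sym
  a≢y = y≢a ∘ sym

module ThreeColoring (G : Graph) (~-sym : Symmetric (_~_ G))
                     (f : V G → Fin 3) (isLid : IsLidColoring G f) where

  Rainbow : V G → Set
  Rainbow u = ∀ c → image G f (N[_] G u) c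

  module _ {u v : V G} (u~v : _~_ G u v) (N≢ : ¬ SameSet G (N[_] G u) (N[_] G v)) where

    not-both-rainbow : Rainbow u → ¬ Rainbow v
    not-both-rainbow Ru Rv = proj₂ isLid u v u~v N≢ λ c → mk⇔ (λ _ → Rv c) (λ _ → Ru c)

    not-neither-rainbow : ¬ Rainbow u → ¬ ¬ Rainbow v
    not-neither-rainbow ¬Ru ¬Rv = proj₂ isLid u v u~v N≢ same
      where
      fu≢fv : f u ≢ f v
      fu≢fv = proj₁ isLid u v u~v

      rainbow : ∀ {w c} → image G f (N[_] G w) (f u) → image G f (N[_] G w) (f v) →
                c ≢ f u → c ≢ f v → image G f (N[_] G w) c → Rainbow w
      rainbow fu∈ fv∈ c≢fu c≢fv c∈ y with y ≟ f u | y ≟ f v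
      ... | yes refl | _        = fu∈
      ... | no _     | yes refl = fv∈
      ... | no y≢fu  | no y≢fv  =
        subst (image G f (N[_] G _)) (Fin3-≢-unique fu≢fv c≢fu c≢fv y≢fu y≢fv) c∈

      same : SameSet G (image G f (N[_] G u)) (image G f (N[_] G v))
      same c with c ≟ f u | c ≟ f v
      ... | yes refl | _        = mk⇔ (λ _ → u , inj₂ (~-sym u~v) , refl) (λ _ → u , inj₁ refl , refl)
      ... | no _     | yes refl = mk⇔ (λ _ → v , inj₁ refl , refl) (λ _ → v , inj₂ u~v , refl)
      ... | no c≢fu  | no c≢fv  = mk⇔
        (⊥-elim ∘ ¬Ru ∘ rainbow (u , inj₁ refl , refl) (v , inj₂ u~v , refl) c≢fu c≢fv)
        (⊥-elim ∘ ¬Rv ∘ rainbow (u , inj₂ (~-sym u~v) , refl) (v , inj₁ refl , refl) c≢fu c≢fv)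

even-induction : (P : ℕ → Set) → (∀ t → P t → P (2 + t)) → P 0 → ∀ q → P (2 * q)
even-induction P step p₀ zero    = p₀
even-induction P step p₀ (suc q) =
  subst P (sym (*-suc 2 q)) (step (2 * q) (even-induction P step p₀ q))

-- Rainbow is not decidable for an arbitrary graph, so its alternation is tracked as ¬ / ¬ ¬.
no-lid-3-coloring : ∀ G → Symmetric (_~_ G) → (w : ℕ → V G) →
                    (∀ t → _~_ G (w t) (w (suc t))) →
                    (∀ t → ¬ SameSet G (N[_] G (w t)) (N[_] G (w (suc t)))) →
                    ∀ {L} → Odd L → w L ≡ w 0 → ¬ LidColorable G 3
no-lid-3-coloring G ~-sym w step N≢ (q , refl) closed (f , isLid) = ¬¬R₀ ¬R₀
  where
  open ThreeColoring G ~-sym f isLid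

  NotRainbow : V G → Set
  NotRainbow u = ¬ Rainbow u

  ¬R⇒¬¬R : ∀ t → ¬ Rainbow (w t) → ¬ ¬ Rainbow (w (suc t))
  ¬R⇒¬¬R t = not-neither-rainbow (step t) (N≢ t)

  ¬¬R⇒¬R : ∀ t → ¬ ¬ Rainbow (w t) → ¬ Rainbow (w (suc t))
  ¬¬R⇒¬R t ¬¬R R′ = ¬¬R λ R → not-both-rainbow (step t) (N≢ t) R R′

  once-around : (P Q : V G → Set) → (∀ t → P (w t) → Q (w (suc t))) →
                (∀ t → Q (w t) → P (w (suc t))) → P (w 0) → Q (w 0)
  once-around P Q P⇒Q Q⇒P p₀ = subst Q closed
    (P⇒Q (2 * q) (even-induction (P ∘ w) (λ t → Q⇒P (suc t) ∘ P⇒Q t) p₀ q))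

  ¬¬R₀ : ¬ ¬ Rainbow (w 0)
  ¬¬R₀ ¬R = once-around NotRainbow (¬_ ∘ NotRainbow) ¬R⇒¬¬R ¬¬R⇒¬R ¬R ¬R

  ¬R₀ : ¬ Rainbow (w 0)
  ¬R₀ = once-around (¬_ ∘ NotRainbow) NotRainbow ¬¬R⇒¬R ¬R⇒¬¬R ¬¬R₀

DistinguishesAdjacent : ∀ G {k} → (V G → Fin k) → Set
DistinguishesAdjacent G g =
  ∀ u v → _~_ G u v → ¬ SameSet G (image G g (N[_] G u)) (image G g (N[_] G v))

⊗-symmetric : ∀ G H → Symmetric (_~_ G) → Symmetric (_~_ H) → Symmetric (_~_ (G ⊗ H))
⊗-symmetric G H symG symH = Product.map symG symH

N-⊗-proj₁ : ∀ G H {x y x′ y′} → N[_] (G ⊗ H) (x , y) (x′ , y′) → N[_] G x x′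
N-⊗-proj₁ G H = Sum.map (cong proj₁) proj₁

⊗-lid-coloring : ∀ G H {k} (g : V G → Fin k) → (∀ y → ∃ (_~_ H y)) →
                 IsProperColoring G g → DistinguishesAdjacent G g →
                 IsLidColoring (G ⊗ H) (g ∘ proj₁)
⊗-lid-coloring G H g neighbour proper distinct = proper′ , lid′
  where
  proper′ : IsProperColoring (G ⊗ H) (g ∘ proj₁)
  proper′ (x , _) (x′ , _) (x~x′ , _) = proper x x′ x~x′

  image-N : ∀ x y → SameSet G (image (G ⊗ H) (g ∘ proj₁) (N[_] (G ⊗ H) (x , y))) (image G g (N[_] G x))
  image-N x y c = mk⇔ to from
    where
    to : image (G ⊗ H) (g ∘ proj₁) (N[_] (G ⊗ H) (x , y)) c → image G g (N[_] G x) c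
    to ((x′ , _) , z∈N , e) = x′ , N-⊗-proj₁ G H z∈N , e

    from : image G g (N[_] G x) c → image (G ⊗ H) (g ∘ proj₁) (N[_] (G ⊗ H) (x , y)) c
    from (_  , inj₁ refl , e) = (x , y) , inj₁ refl , e
    from (x′ , inj₂ x~x′ , e) = (x′ , proj₁ (neighbour y)) , inj₂ (x~x′ , proj₂ (neighbour y)) , e

  lid′ : ∀ u v → _~_ (G ⊗ H) u v → ¬ SameSet (G ⊗ H) (N[_] (G ⊗ H) u) (N[_] (G ⊗ H) v) →
         ¬ SameSet (G ⊗ H) (image (G ⊗ H) (g ∘ proj₁) (N[_] (G ⊗ H) u))
                           (image (G ⊗ H) (g ∘ proj₁) (N[_] (G ⊗ H) v))
  lid′ (x , y) (x′ , y′) (x~x′ , _) _ same =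
    distinct x x′ x~x′ λ c → image-N x′ y′ c ⇔-∘ (same c ⇔-∘ ⇔-sym (image-N x y c))

Cycle-symmetric : ∀ {m} → Symmetric (_~_ (Cycle m))
Cycle-symmetric = Sum.swap

CycSucc-functional : ∀ {m i j j′} → CycSucc m i j → CycSucc m i j′ → j ≡ j′
CycSucc-functional (inj₁ e) (inj₁ e′) = toℕ-injective (trans e (sym e′))
CycSucc-functional (inj₂ (_ , e)) (inj₂ (_ , e′)) = toℕ-injective (trans e (sym e′))
CycSucc-functional {j = j} (inj₁ e) (inj₂ (1+i≡m , _)) = ⊥-elim (<-irrefl (trans e 1+i≡m) (toℕ<n j))
CycSucc-functional {j′ = j′} (inj₂ (1+i≡m , _)) (inj₁ e′) = ⊥-elim (<-irrefl (trans e′ 1+i≡m) (toℕ<n j′))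

[m+n%d]%d≡[m+n]%d : ∀ m n d → (m + n % suc d) % suc d ≡ (m + n) % suc d
[m+n%d]%d≡[m+n]%d m n d = begin
  (m + n % suc d) % suc d                  ≡⟨ %-distribˡ-+ m (n % suc d) (suc d) ⟩
  (m % suc d + n % suc d % suc d) % suc d  ≡⟨ cong (λ r → (m % suc d + r) % suc d) (m%n%n≡m%n n (suc d)) ⟩
  (m % suc d + n % suc d) % suc d          ≡⟨ %-distribˡ-+ m n (suc d) ⟨
  (m + n) % suc d                          ∎

-- The two conditions beyond properness say {a, b, c} ≠ {b, c, d}: the colours seen by the
-- closed neighbourhoods of the middle edge of a path coloured a b c d.
Window : Fin 4 → Fin 4 → Fin 4 → Fin 4 → Set
Window a b c d = a ≢ b × b ≢ c × c ≢ d × a ≢ d × ¬ (a ≡ c × b ≡ d)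

Window-sets-differ : ∀ {a b c d} → Window a b c d →
                     a ≡ b ⊎ a ≡ c ⊎ a ≡ d → ¬ (d ≡ a ⊎ d ≡ b ⊎ d ≡ c)
Window-sets-differ (a≢b , _ , _ , _ , _) (inj₁ a≡b) _ = a≢b a≡b
Window-sets-differ (_ , _ , _ , a≢d , _) (inj₂ (inj₂ a≡d)) _ = a≢d a≡d
Window-sets-differ (_ , _ , _ , a≢d , _) (inj₂ (inj₁ _)) (inj₁ d≡a) = a≢d (sym d≡a)
Window-sets-differ (_ , _ , _ , _ , no-swap) (inj₂ (inj₁ a≡c)) (inj₂ (inj₁ d≡b)) = no-swap (a≡c , sym d≡b)
Window-sets-differ (_ , _ , c≢d , _ , _) (inj₂ (inj₁ _)) (inj₂ (inj₂ d≡c)) = c≢d (sym d≡c)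

module Rotation (k : ℕ) where

  C : Graph
  C = Cycle (suc k)

  rot : ℕ → Fin (suc k) → Fin (suc k)
  rot d i = (d + toℕ i) mod suc k

  next : Fin (suc k) → Fin (suc k)
  next = rot 1

  toℕ-rot : ∀ d i → toℕ (rot d i) ≡ (d + toℕ i) % suc k
  toℕ-rot d i = toℕ-fromℕ< _

  rot-rot : ∀ d e i → rot d (rot e i) ≡ rot (d + e) i
  rot-rot d e i = toℕ-injective (begin
    toℕ (rot d (rot e i))              ≡⟨ toℕ-rot d (rot e i) ⟩
    (d + toℕ (rot e i)) % suc k        ≡⟨ cong (λ r → (d + r) % suc k) (toℕ-rot e i) ⟩
    (d + (e + toℕ i) % suc k) % suc k  ≡⟨ [m+n%d]%d≡[m+n]%d d (e + toℕ i) k ⟩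
    (d + (e + toℕ i)) % suc k          ≡⟨ cong (_% suc k) (+-assoc d e (toℕ i)) ⟨
    (d + e + toℕ i) % suc k            ≡⟨ toℕ-rot (d + e) i ⟨
    toℕ (rot (d + e) i)                ∎)

  rot-period : ∀ {d} → suc k ∣ d → ∀ i → rot d i ≡ i
  rot-period (divides q refl) i = toℕ-injective (begin
    toℕ (rot (q * suc k) i)       ≡⟨ toℕ-rot (q * suc k) i ⟩
    (q * suc k + toℕ i) % suc k   ≡⟨ cong (_% suc k) (+-comm (q * suc k) (toℕ i)) ⟩
    (toℕ i + q * suc k) % suc k   ≡⟨ [m+kn]%n≡m%n (toℕ i) q (suc k) ⟩
    toℕ i % suc k                 ≡⟨ m<n⇒m%n≡m (toℕ<n i) ⟩
    toℕ i                         ∎)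

  rot-fixed⇒∣ : ∀ d i → rot d i ≡ i → suc k ∣ d
  rot-fixed⇒∣ d i fixed = divides q (+-cancelˡ-≡ (toℕ i) d (q * suc k) (begin
    toℕ i + d                          ≡⟨ +-comm (toℕ i) d ⟩
    d + toℕ i                          ≡⟨ m≡m%n+[m/n]*n (d + toℕ i) (suc k) ⟩
    (d + toℕ i) % suc k + q * suc k    ≡⟨ cong (_+ q * suc k) (trans (sym (toℕ-rot d i)) (cong toℕ fixed)) ⟩
    toℕ i + q * suc k                  ∎))
    where
    q = (d + toℕ i) / suc k

  rot-suc-not-fixed : ∀ {d} i → suc d < suc k → rot (suc d) i ≢ i
  rot-suc-not-fixed i d<k = <⇒≱ d<k ∘ ∣⇒≤ ∘ rot-fixed⇒∣ _ i

  next-rot-k : ∀ i → next (rot k i) ≡ i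
  next-rot-k i = trans (rot-rot 1 k i) (rot-period ∣-refl i)

  rot-k-next : ∀ i → rot k (next i) ≡ i
  rot-k-next i = trans (rot-rot k 1 i) (rot-period (∣-reflexive (+-comm 1 k)) i)

  next-injective : ∀ {i j} → next i ≡ next j → i ≡ j
  next-injective {i} {j} e = trans (sym (rot-k-next i)) (trans (cong (rot k) e) (rot-k-next j))

  CycSucc-next : ∀ i → CycSucc (suc k) i (next i)
  CycSucc-next i with m≤n⇒m<n∨m≡n (toℕ<n i)
  ... | inj₁ 1+i<m = inj₁ (trans (toℕ-rot 1 i) (m<n⇒m%n≡m 1+i<m))
  ... | inj₂ 1+i≡m = inj₂ (1+i≡m , trans (toℕ-rot 1 i) (trans (cong (_% suc k) 1+i≡m) (n%n≡0 (suc k))))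

  next-adjacent : ∀ i → _~_ C i (next i)
  next-adjacent i = inj₁ (CycSucc-next i)

  adjacent⇒next : ∀ {i j} → _~_ C i j → j ≡ next i ⊎ i ≡ next j
  adjacent⇒next = Sum.map (λ c → CycSucc-functional c (CycSucc-next _))
                          (λ c → CycSucc-functional c (CycSucc-next _))

  rot-suc-adjacent : ∀ t i → _~_ C (rot t i) (rot (suc t) i)
  rot-suc-adjacent t i = subst (_~_ C (rot t i)) (rot-rot 1 t i) (next-adjacent (rot t i))

  rot2-∉-N : 3 < suc k → ∀ x → ¬ N[_] C x (rot 2 x)
  rot2-∉-N 3<m x (inj₁ e) = rot-suc-not-fixed x 2<m e
    where 2<m = <-trans (n<1+n 2) 3<m
  rot2-∉-N 3<m x (inj₂ x~x″) with adjacent⇒next x~x″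
  ... | inj₁ e = rot-suc-not-fixed (next x) 1<m (trans (rot-rot 1 1 x) e)
    where 1<m = <-trans (n<1+n 1) (<-trans (n<1+n 2) 3<m)
  ... | inj₂ e = rot-suc-not-fixed x 3<m (sym (trans e (rot-rot 1 2 x)))

  N-next-cases : ∀ {x z} → N[_] C (next x) z → z ≡ x ⊎ z ≡ next x ⊎ z ≡ next (next x)
  N-next-cases (inj₁ e) = inj₂ (inj₁ e)
  N-next-cases (inj₂ adj) with adjacent⇒next adj
  ... | inj₁ e = inj₂ (inj₂ e)
  ... | inj₂ e = inj₁ (sym (next-injective e))

  module WindowColoring (g : Fin (suc k) → Fin 4)
           (window : ∀ p → Window (g p) (g (next p)) (g (next (next p))) (g (next (next (next p)))))
           where

    proper : IsProperColoring C g
    proper u v u~v gu≡gv with adjacent⇒next u~v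
    ... | inj₁ e = proj₁ (window u) (trans gu≡gv (cong g e))
    ... | inj₂ e = proj₁ (window v) (trans (sym gu≡gv) (cong g e))

    colour-N-next : ∀ {x c} → image C g (N[_] C (next x)) c →
                    c ≡ g x ⊎ c ≡ g (next x) ⊎ c ≡ g (next (next x))
    colour-N-next (z , z∈N , refl) = Sum.map (cong g) (Sum.map (cong g) (cong g)) (N-next-cases z∈N)

    Separated : Fin (suc k) → Fin (suc k) → Set
    Separated x y = ¬ SameSet C (image C g (N[_] C x)) (image C g (N[_] C y))

    separated-after : ∀ p → Separated (next p) (next (next p))
    separated-after p same = Window-sets-differ (window p)
      (colour-N-next (Equivalence.to (same (g p)) (p , inj₂ (Cycle-symmetric (next-adjacent p)) , refl)))
      (colour-N-next (Equivalence.from (same (g p‴)) (p‴ , inj₂ (next-adjacent _) , refl)))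
      where
      p‴ = next (next (next p))

    separated-next : ∀ x → Separated x (next x)
    separated-next x = subst (λ y → Separated y (next y)) (next-rot-k x) (separated-after (rot k x))

    distinguishes : DistinguishesAdjacent C g
    distinguishes u v u~v with adjacent⇒next u~v
    ... | inj₁ refl = separated-next u
    ... | inj₂ refl = separated-next v ∘ SameSet-sym C

Cycle-no-isolated : ∀ {n} (y : Fin n) → ∃ (_~_ (Cycle n) y)
Cycle-no-isolated {suc k} y = next y , next-adjacent y
  where open Rotation k

odd-* : ∀ {m n} → Odd m → Odd n → Odd (m * n)
odd-* {n = n} (a , refl) (b , refl) = b + a * n , cong suc (begin
  2 * b + 2 * a * n    ≡⟨ cong (2 * b +_) (*-assoc 2 a n) ⟩
  2 * b + 2 * (a * n)  ≡⟨ *-distribˡ-+ 2 b (a * n) ⟨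
  2 * (b + a * n)      ∎)

odd-cycles-⊗-no-lid-3 : ∀ {m n} → 3 < m → Odd m → Odd n → ¬ LidColorable (Cycle m ⊗ Cycle n) 3
odd-cycles-⊗-no-lid-3 {suc k} {suc l} 3<m odd-m odd-n =
  no-lid-3-coloring (R₁.C ⊗ R₂.C) (⊗-symmetric R₁.C R₂.C Cycle-symmetric Cycle-symmetric)
    diagonal step N≢ (odd-* odd-m odd-n) closed
  where
  module R₁ = Rotation k
  module R₂ = Rotation l

  diagonal : ℕ → Fin (suc k) × Fin (suc l)
  diagonal t = R₁.rot t zero , R₂.rot t zero

  step : ∀ t → _~_ (R₁.C ⊗ R₂.C) (diagonal t) (diagonal (suc t))
  step t = R₁.rot-suc-adjacent t zero , R₂.rot-suc-adjacent t zero

  N≢ : ∀ t → ¬ SameSet (R₁.C ⊗ R₂.C) (N[_] (R₁.C ⊗ R₂.C) (diagonal t))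
                                      (N[_] (R₁.C ⊗ R₂.C) (diagonal (suc t)))
  N≢ t same = R₁.rot2-∉-N 3<m (R₁.rot t zero)
    (subst (N[_] R₁.C (R₁.rot t zero)) (sym (R₁.rot-rot 2 t zero))
      (N-⊗-proj₁ R₁.C R₂.C (Equivalence.from (same (diagonal (2 + t))) (inj₂ (step (suc t))))))

  closed : diagonal (suc k * suc l) ≡ diagonal 0
  closed = cong₂ _,_ (R₁.rot-period (m∣m*n {suc k} (suc l)) zero)
                     (R₂.rot-period (n∣m*n (suc k) {suc l}) zero)

at : List (Fin 4) → ℕ → Fin 4
at []      _       = zero
at (c ∷ w) zero    = c
at (c ∷ w) (suc i) = at w i

at-++ : ∀ u w i → at (u ++ w) (length u + i) ≡ at w i
at-++ []      w i = refl
at-++ (_ ∷ u) w i = at-++ u w i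

Windows : List (Fin 4) → Set
Windows (a ∷ b ∷ c ∷ d ∷ w) = Window a b c d × Windows (b ∷ c ∷ d ∷ w)
Windows _                   = ⊤

Windows-at : ∀ w i → Windows w → 3 + i < length w →
             Window (at w i) (at w (1 + i)) (at w (2 + i)) (at w (3 + i))
Windows-at (a ∷ b ∷ c ∷ d ∷ w) zero    (W , _)  _         = W
Windows-at (a ∷ b ∷ c ∷ d ∷ w) (suc i) (_ , Ws) (s≤s 3+i<) = Windows-at (b ∷ c ∷ d ∷ w) i Ws 3+i<
Windows-at (_ ∷ []) _ _ (s≤s ())
Windows-at (_ ∷ _ ∷ []) _ _ (s≤s (s≤s ()))
Windows-at (_ ∷ _ ∷ _ ∷ []) _ _ (s≤s (s≤s (s≤s ())))

window? : ∀ a b c d → Dec (Window a b c d)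
window? a b c d =
  ¬? (a ≟ b) ×-dec ¬? (b ≟ c) ×-dec ¬? (c ≟ d) ×-dec ¬? (a ≟ d) ×-dec ¬? (a ≟ c ×-dec b ≟ d)

windows? : ∀ w → Dec (Windows w)
windows? (a ∷ b ∷ c ∷ d ∷ w) = window? a b c d ×-dec windows? (b ∷ c ∷ d ∷ w)
windows? []                  = yes tt
windows? (_ ∷ [])            = yes tt
windows? (_ ∷ _ ∷ [])        = yes tt
windows? (_ ∷ _ ∷ _ ∷ [])    = yes tt

Window-cong : ∀ {a b c d a′ b′ c′ d′} → a ≡ a′ → b ≡ b′ → c ≡ c′ → d ≡ d′ →
              Window a b c d → Window a′ b′ c′ d′
Window-cong refl refl refl refl W = W

-- The cyclic word a b c r, read on C_m with m = 3 + length r; 'closed' appends its first three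
-- letters so that every cyclic window is a window of a linear word.
module CyclicWord (a b c : Fin 4) (r : List (Fin 4)) where

  word : List (Fin 4)
  word = a ∷ b ∷ c ∷ r

  closed : List (Fin 4)
  closed = word ++ a ∷ b ∷ c ∷ []

  open Rotation (2 + length r)

  colouring : Fin (length word) → Fin 4
  colouring x = at closed (toℕ x)

  wrap : ∀ t → t < 3 → at closed (length word + t) ≡ at closed t
  wrap t t<3 = trans (at-++ word (a ∷ b ∷ c ∷ []) t) (head t t<3)
    where
    head : ∀ t → t < 3 → at (a ∷ b ∷ c ∷ []) t ≡ at closed t
    head 0 _ = refl
    head 1 _ = refl
    head 2 _ = refl
    head (suc (suc (suc _))) (s≤s (s≤s (s≤s ())))

  shift : ∀ t → t < 3 → ∀ x → at closed (suc t + toℕ x) ≡ at closed (t + toℕ (next x))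
  shift t t<3 x with CycSucc-next x
  ... | inj₁ next≡1+x = cong (at closed) (trans (sym (+-suc t (toℕ x))) (cong (t +_) (sym next≡1+x)))
  ... | inj₂ (1+x≡m , next≡0) = begin
    at closed (suc t + toℕ x)          ≡⟨ cong (at closed) (trans (sym (+-suc t (toℕ x))) (+-comm t _)) ⟩
    at closed (suc (toℕ x) + t)        ≡⟨ cong (λ i → at closed (i + t)) 1+x≡m ⟩
    at closed (length word + t)        ≡⟨ wrap t t<3 ⟩
    at closed t                        ≡⟨ cong (at closed) (+-identityʳ t) ⟨
    at closed (t + 0)                  ≡⟨ cong (λ i → at closed (t + i)) next≡0 ⟨
    at closed (t + toℕ (next x))       ∎

  colouring-window : Windows closed → ∀ p → Window (colouring p) (colouring (next p))
                                                   (colouring (next (next p))) (colouring (next (next (next p))))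
  colouring-window Ws p = Window-cong refl
    (shift 0 lt₀ p)
    (trans (shift 1 lt₁ p) (shift 0 lt₀ (next p)))
    (trans (shift 2 lt₂ p) (trans (shift 1 lt₁ (next p)) (shift 0 lt₀ (next (next p)))))
    (Windows-at closed (toℕ p) Ws 3+p<)
    where
    lt₀ = s≤s z≤n
    lt₁ = s≤s (s≤s z≤n)
    lt₂ = s≤s (s≤s (s≤s z≤n))
    3+p< : 3 + toℕ p < length closed
    3+p< = subst (3 + toℕ p <_) (trans (+-comm 3 (length word)) (sym (length-++ word)))
                 (+-monoʳ-< 3 (toℕ<n p))

  lid-coloring : ∀ H → (∀ y → ∃ (_~_ H y)) → Windows closed → LidColorable (C ⊗ H) 4
  lid-coloring H neighbour Ws = colouring ∘ proj₁ ,
    ⊗-lid-coloring C H colouring neighbour proper distinguishes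
    where open WindowColoring colouring (colouring-window Ws)

-- For j = 2i + ε the word 0102 · coda j is (0102)^(i+1) 01323 (ε = 0) or (0102)^(i+1) 0131203
-- (ε = 1).
coda : ℕ → List (Fin 4)
coda 0             = # 0 ∷ # 1 ∷ # 3 ∷ # 2 ∷ # 3 ∷ []
coda 1             = # 0 ∷ # 1 ∷ # 3 ∷ # 1 ∷ # 2 ∷ # 0 ∷ # 3 ∷ []
coda (suc (suc j)) = # 0 ∷ # 1 ∷ # 0 ∷ # 2 ∷ coda j

length-coda : ∀ j → length (coda j) ≡ 5 + 2 * j
length-coda 0             = refl
length-coda 1             = refl
length-coda (suc (suc j)) = begin
  4 + length (coda j)   ≡⟨ cong (4 +_) (length-coda j) ⟩
  4 + (5 + 2 * j)       ≡⟨ cong (5 +_) (trans (*-suc 2 (suc j)) (cong (2 +_) (*-suc 2 j))) ⟨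
  5 + 2 * suc (suc j)   ∎

module Coda (j : ℕ) = CyclicWord (# 0) (# 1) (# 0) (# 2 ∷ coda j)

-- Stated with does rather than True: isYes, behind True, is stuck on the symbolic tail coda j,
-- while does unfolds through the concrete windows in front of it.
coda-check : ∀ j → T (does (windows? (Coda.closed j)))
coda-check 0             = tt
coda-check 1             = tt
coda-check (suc (suc j)) = coda-check j

coda-windows : ∀ j → Windows (Coda.closed j)
coda-windows j = toWitness {a? = windows? (Coda.closed j)}
                           (subst T (sym (isYes≗does (windows? (Coda.closed j)))) (coda-check j))

odd-≥9 : ∀ {m} → Odd m → m ≥ 9 → ∃ λ j → m ≡ 9 + 2 * j
odd-≥9 (k , refl) 9≤m with m≤n⇒∃[o]m+o≡n (*-cancelˡ-≤ {m = 4} {n = k} 2 (≤-pred 9≤m))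
... | j , refl = j , cong suc (*-distribˡ-+ 2 4 j)

odd-cycle-⊗-lid-4 : ∀ {m} → Odd m → m ≥ 9 → ∀ H → (∀ y → ∃ (_~_ H y)) → LidColorable (Cycle m ⊗ H) 4
odd-cycle-⊗-lid-4 odd-m m≥9 H neighbour with odd-≥9 odd-m m≥9
... | j , refl = subst (λ m → LidColorable (Cycle m ⊗ H) 4) (cong (4 +_) (length-coda j))
  (Coda.lid-coloring j H neighbour (coda-windows j))

lemma20 : (m n : ℕ) → Odd m → Odd n → m ≥ 9 → n ≥ 3 →
          χlid≡ (Cycle m ⊗ Cycle n) 4
lemma20 m n odd-m odd-n m≥9 _ =
  odd-cycle-⊗-lid-4 odd-m m≥9 (Cycle n) Cycle-no-isolated ,
  λ c c<4 → odd-cycles-⊗-no-lid-3 (≤-trans (s≤s (s≤s (s≤s (s≤s z≤n)))) m≥9) odd-m odd-n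
          ∘ LidColorable-mono (Cycle m ⊗ Cycle n) (≤-pred c<4)
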